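{- Let $\mathbf{C}$ be a class of dependence structures such that $\mathbf{C}$ contains a closure operator dependence structure $\mathcal{D}_{(M,\mathrm{cl})}$ for some closure system $(M,\mathrm{cl})$ with $\emptyset\neq\mathrm{cl}(\emptyset)\neq M$. Then for every set $\Sigma$ of dependence atoms and every dependence atom $\phi$, $$\Sigma\vdash_{\mathcal{D}}\phi\iff\Sigma\models_{\mathbf{C}}\phi.$$
   Context: Syntax: fix a set $\mathrm{Var}$ of variables; $\vec{x},\vec{y},\dots$ denote finite sequences of variables, $\emptyset$ the empty sequence, $\vec{x}\vec{y}$ concatenation. A dependence atom is $\mathrm{dep}(\vec{x},\vec{y})$ where $\vec{y}\neq\emptyset$ whenever $\vec{x}\ne\emptyset$. Deductive system $\vdash_{\mathcal{D}}$: $\Sigma\vdash_{\mathcal{D}}\phi$ means $\phi$ lies in the smallest set containing $\Sigma$ closed under: (a) $\mathrm{dep}(\vec{x},\vec{x})$ (including $\mathrm{dep}(\emptyset,\emptyset)$); (b) from $\mathrm{dep}(\vec{x},\vec{y}\vec{z})$ infer $\mathrm{dep}(\vec{x}\vec{u},\vec{y})$; (c) from $\mathrm{dep}(\vec{x},\vec{y})$ and $\mathrm{dep}(\vec{y},\vec{z})$ infer $\mathrm{dep}(\vec{x},\vec{z})$; (d) from $\mathrm{dep}(\vec{x},\vec{y})$ and $\mathrm{dep}(\vec{x},\vec{v})$ infer $\mathrm{dep}(\vec{x},\vec{y}\vec{v})$; (e) from $\mathrm{dep}(\vec{x},\vec{y})$ infer $\mathrm{dep}(\vec{z},\vec{y})$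 for any permutation $\vec{z}$ of $\vec{x}$. A dependence structure is a pair $(I,\Rightarrow)$, $I$ non-empty, $\Rightarrow$ a binary relation on finite subsets of $I$ such that for all finite $\mathbf{x},\mathbf{y},\mathbf{z},\mathbf{u}$ (writing $\mathbf{x}\mathbf{y}$ for $\mathbf{x}\cup\mathbf{y}$): $\mathbf{x}\Rightarrow\mathbf{x}$; if $\mathbf{x}\Rightarrow\mathbf{y}\mathbf{z}$ then $\mathbf{x}\mathbf{u}\Rightarrow\mathbf{y}$; if $\mathbf{x}\Rightarrow\mathbf{y}$ and $\mathbf{y}\Rightarrow\mathbf{z}$ then $\mathbf{x}\Rightarrow\mathbf{z}$; if $\mathbf{x}\Rightarrow\mathbf{y}$ and $\mathbf{x}\Rightarrow\mathbf{z}$ then $\mathbf{x}\Rightarrow\mathbf{y}\mathbf{z}$. A closure system $(M,\mathrm{cl})$ is a set $M$ with $\mathrm{cl}:\mathcal{P}(M)\to\mathcal{P}(M)$ satisfying $A\subseteq\mathrm{cl}(A)$, $A\subseteq B\Rightarrow\mathrm{cl}(A)\subseteq\mathrm{cl}(B)$, $\mathrm{cl}(\mathrm{cl}(A))=\mathrm{cl}(A)$. Its closure operator dependence structure is $\mathcal{D}_{(M,\mathrm{cl})}=(M,\Rightarrow)$ with $\mathbf{x}\Rightarrow\mathbf{y}$ iff $\mathbf{y}\subseteq\mathrm{cl}(\mathbf{x})$. Semantics: an assignment into $(I,\Rightarrow)$ is $s:\mathrm{Var}\to I$, with $s((x_0,\dots,x_{n-1}))=\{s(x_0),\dots,s(x_{n-1})\}$;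 $(I,\Rightarrow)\models_s\mathrm{dep}(\vec{x},\vec{y})$ iff $s(\vec{x})\Rightarrow s(\vec{y})$. $\Sigma\models_{\mathbf{C}}\phi$ means every assignment into any structure in $\mathbf{C}$ satisfying all of $\Sigma$ satisfies $\phi$. -}

module Defs where

open import Level using (0ℓ)
open import Data.List using (List; []; _++_; map)
open import Data.List.Membership.Propositional using (_∈_)
open import Data.List.Relation.Binary.Permutation.Propositional using (_↭_)
open import Data.Product using (_×_; Σ)
open import Relation.Nullary using (¬_)
open import Relation.Binary.PropositionalEquality using (_≡_; _≢_)
open import Axiom.ExcludedMiddle using (ExcludedMiddle)

-- Syntax.  A dependence atom dep(xs , ys) is a pair of finite sequences
-- of variables (lists) subject to: ys ≠ ∅ whenever xs ≠ ∅.

WF : {Var : Set} → List Var → List Var → Set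
WF xs ys = xs ≢ [] → ys ≢ []

AtomSet : Set → Set₁
AtomSet Var = List Var → List Var → Set

IsAtomSet : {Var : Set} → AtomSet Var → Set
IsAtomSet {Var} Σ' = ∀ (xs ys : List Var) → Σ' xs ys → WF xs ys

-- Rule (b) is only applied when its conclusion is
-- an atom (the other rules always produce atoms from atoms).
data _⊢_,_ {Var : Set} (Σ' : AtomSet Var) : List Var → List Var → Set where
  ax    : ∀ {xs ys} → Σ' xs ys → Σ' ⊢ xs , ys
  refl-dep : ∀ xs → Σ' ⊢ xs , xs                                   -- (a)
  proj  : ∀ {xs ys zs} us → WF (xs ++ us) ys →
          Σ' ⊢ xs , (ys ++ zs) → Σ' ⊢ (xs ++ us) , ys              -- (b)
  trans-dep : ∀ {xs ys zs} → Σ' ⊢ xs , ys → Σ' ⊢ ys , zs →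
              Σ' ⊢ xs , zs                                         -- (c)
  union : ∀ {xs ys vs} → Σ' ⊢ xs , ys → Σ' ⊢ xs , vs →
          Σ' ⊢ xs , (ys ++ vs)                                     -- (d)
  perm  : ∀ {xs zs ys} → xs ↭ zs → Σ' ⊢ xs , ys → Σ' ⊢ zs , ys      -- (e)

-- Finite subsets of I are represented by lists
-- over I, identified up to having the same elements; union is _++_.
-- A relation on finite subsets is thus a relation on lists invariant
-- under same-elements.

SameElems : {I : Set} → List I → List I → Set
SameElems xs ys = ∀ {a} → (a ∈ xs → a ∈ ys) × (a ∈ ys → a ∈ xs)

record IsDepStructure (I : Set) (_⇒_ : List I → List I → Set) : Set where
  field
    nonempty   : I
    respects   : ∀ {x x' y y'} → SameElems x x' → SameElems y y' →
                 x ⇒ y → x' ⇒ y'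
    reflexive  : ∀ x → x ⇒ x
    projective : ∀ x y z u → x ⇒ (y ++ z) → (x ++ u) ⇒ y
    transitive : ∀ x y z → x ⇒ y → y ⇒ z → x ⇒ z
    additive   : ∀ x y z → x ⇒ y → x ⇒ z → x ⇒ (y ++ z)

-- Closure systems (subsets of M as predicates M → Set; equality of
-- subsets as mutual inclusion).

Sub : Set → Set₁
Sub M = M → Set

_⊆_ : {M : Set} → Sub M → Sub M → Set
A ⊆ B = ∀ {m} → A m → B m

record IsClosureSystem (M : Set) (cl : Sub M → Sub M) : Set₁ where
  field
    extensive  : ∀ A → A ⊆ cl A
    monotone   : ∀ A B → A ⊆ B → cl A ⊆ cl B
    idempotent : ∀ A → (cl (cl A) ⊆ cl A) × (cl A ⊆ cl (cl A))

ClDep : (M : Set) → (Sub M → Sub M) → List M → List M → Set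
ClDep M cl xs ys = ∀ {m} → m ∈ ys → cl (λ a → a ∈ xs) m

emptySub : {M : Set} → Sub M
emptySub _ = Data.Empty.⊥
  where import Data.Empty

Class : Set₂
Class = (I : Set) → (List I → List I → Set) → Set₁

_⊨[_]_,_ : {Var : Set} → AtomSet Var → Class → List Var → List Var → Set₁
_⊨[_]_,_ {Var} Σ' C xs ys =
  ∀ (I : Set) (_⇒_ : List I → List I → Set) → C I _⇒_ →
  (s : Var → I) →
  (∀ us vs → Σ' us vs → map s us ⇒ map s vs) →
  map s xs ⇒ map s ys

-- Soundness is a routine induction on derivations: each rule (a)–(e) is
-- one of the axioms of a dependence structure (rule (e) is invariance under
-- having the same elements).
--
-- Completeness uses a two-point countermodel inside D_(M,cl).  Fix a ∈ cl(∅)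
-- and b ∉ cl(∅) (extracted classically from the hypotheses) and let T be
-- the set of variables v with Σ ⊢ dep(xs, v).  The assignment sending T to
-- a and everything else to b satisfies every atom dep(us, vs) for which T
-- is "closed" (us ⊆ T implies vs ⊆ T), and whenever it satisfies dep(xs, ys)
-- with xs ⊆ T we get ys ⊆ T.  T is closed under Σ, contains xs, and a
-- derivation of dep(xs, ys) is assembled from derivations of its members.
module Submission where

open import Defs
open import Level using (0ℓ)
open import Data.List using (List; []; _∷_; [_]; _++_; map)
open import Data.List.Membership.Propositional using (_∈_; find)
open import Data.List.Membership.Propositional.Properties using (∈-map⁺; ∈-map⁻; ∈-∃++)
open import Data.List.Relation.Unary.All as All using (All; []; _∷_; all?)
open import Data.List.Relation.Unary.All.Properties using (¬All⇒Any¬)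
open import Data.List.Relation.Binary.Permutation.Propositional using (↭-sym)
open import Data.List.Relation.Binary.Permutation.Propositional.Properties using (∈-resp-↭; map⁺; shift)
open import Data.List.Properties using (map-++)
open import Data.Product using (_×_; Σ; _,_; ∃; proj₁; proj₂)
open import Data.Empty using (⊥-elim)
open import Function using (id)
open import Function.Bundles using (_⇔_; mk⇔)
open import Relation.Nullary using (¬_; yes; no)
open import Relation.Nullary.Decidable using (decidable-stable)
open import Relation.Unary using (Decidable)
open import Relation.Binary.PropositionalEquality using (_≡_; refl; subst; sym)
open import Axiom.ExcludedMiddle using (ExcludedMiddle)
open import Axiom.DoubleNegationElimination using (em⇒dne)

Satisfies : {Var I : Set} → AtomSet Var → (List I → List I → Set) → (Var → I) → Set
Satisfies Σ' _⇒_ s = ∀ us vs → Σ' us vs → map s us ⇒ map s vs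

module _ {I : Set} {_⇒_ : List I → List I → Set} (D : IsDepStructure I _⇒_)
         {Var : Set} {Σ' : AtomSet Var} {s : Var → I}
         (sat : Satisfies Σ' _⇒_ s) where
  open IsDepStructure D

  sound : ∀ {xs ys} → Σ' ⊢ xs , ys → map s xs ⇒ map s ys
  sound (ax σ)          = sat _ _ σ
  sound (refl-dep xs)   = reflexive (map s xs)
  sound (proj {xs} {ys} {zs} us _ d) =
    subst (_⇒ map s ys) (sym (map-++ s xs us))
      (projective _ _ (map s zs) _ (subst (map s xs ⇒_) (map-++ s ys zs) (sound d)))
  sound (trans-dep d e) = transitive _ _ _ (sound d) (sound e)
  sound (union {xs} {ys} {vs} d e) =
    subst (map s xs ⇒_) (sym (map-++ s ys vs)) (additive _ _ _ (sound d) (sound e))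
  sound (perm {xs} {zs} p d) = respects sameElems (id , id) (sound d)
    where
    sameElems : SameElems (map s xs) (map s zs)
    sameElems = ∈-resp-↭ (map⁺ s p) , ∈-resp-↭ (↭-sym (map⁺ s p))

module Derivations {Var : Set} (Σ' : AtomSet Var) where

  member : ∀ {v vs} → v ∈ vs → Σ' ⊢ vs , [ v ]
  member {v} v∈ with ∈-∃++ v∈
  ... | ys , zs , refl =
    perm (↭-sym (shift v ys zs))
         (proj {xs = [ v ]} {zs = []} (ys ++ zs) (λ _ ()) (refl-dep [ v ]))

  Determined : List Var → Var → Set
  Determined xs v = Σ' ⊢ xs , [ v ]

  collect : ∀ {xs y ys} → All (Determined xs) (y ∷ ys) → Σ' ⊢ xs , (y ∷ ys)
  collect (d ∷ [])      = d
  collect (d ∷ e ∷ ds)  = union d (collect (e ∷ ds))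

  -- The same for any well-formed conclusion (the empty one forces xs = ∅).
  fromMembers : ∀ {xs} ys → WF xs ys → All (Determined xs) ys → Σ' ⊢ xs , ys
  fromMembers {[]}    []       _  _  = refl-dep []
  fromMembers {_ ∷ _} []       wf _  = ⊥-elim (wf (λ ()) refl)
  fromMembers         (_ ∷ _)  _  ds = collect ds

  -- The determined variables are closed under the atoms of Σ'
  -- (for an atom with empty antecedent, weaken it to antecedent xs).
  closedUnderΣ : ∀ {xs us vs} → Σ' us vs →
                 All (Determined xs) us → All (Determined xs) vs
  closedUnderΣ {xs} {[]} σ [] = All.tabulate λ v∈ →
    proj {xs = []} {zs = []} xs (λ _ ()) (trans-dep (ax σ) (member v∈))
  closedUnderΣ {us = _ ∷ _} σ ds = All.tabulate λ v∈ →
    trans-dep (trans-dep (collect ds) (ax σ)) (member v∈)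

module TwoPoint {M : Set} {cl : Sub M → Sub M} (isC : IsClosureSystem M cl)
                {a b : M} (a∈cl∅ : cl emptySub a) (b∉cl∅ : ¬ cl emptySub b)
                {Var : Set} {T : Var → Set} (T? : Decidable T) where
  open IsClosureSystem isC

  val : Var → M
  val v with T? v
  ... | yes _ = a
  ... | no  _ = b

  val-in : ∀ {v} → T v → val v ≡ a
  val-in {v} t with T? v
  ... | yes _ = refl
  ... | no ¬t = ⊥-elim (¬t t)

  val-out : ∀ {v} → ¬ T v → val v ≡ b
  val-out {v} ¬t with T? v
  ... | yes t = ⊥-elim (¬t t)
  ... | no _  = refl

  -- a lies in every closed set, since cl(∅) ⊆ cl(A).
  a∈cl : ∀ A → cl A a
  a∈cl A = monotone emptySub A (λ ()) a∈cl∅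

  -- An atom dep(us, vs) holds as soon as T is closed under it: if some
  -- u ∈ us lies outside T, then b ∈ cl(val us) and every value is a or b.
  satisfies : ∀ us vs → (All T us → All T vs) → ClDep M cl (map val us) (map val vs)
  satisfies us vs closed m∈ with ∈-map⁻ val m∈
  ... | v , v∈ , refl with T? v
  ...   | yes _  = a∈cl _
  ...   | no ¬Tv with all? T? us
  ...     | yes Tus = ⊥-elim (¬Tv (All.lookup (closed Tus) v∈))
  ...     | no ¬Tus with find (¬All⇒Any¬ T? us ¬Tus)
  ...       | u , u∈ , ¬Tu = subst (cl _) (val-out ¬Tu) (extensive _ (∈-map⁺ val u∈))

  -- Conversely, a satisfied atom dep(xs, ys) with xs ⊆ T has ys ⊆ T:
  -- cl(val xs) ⊆ cl(cl(∅)) = cl(∅), which does not contain b.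
  reflects : ∀ xs ys → ClDep M cl (map val xs) (map val ys) → All T xs → All T ys
  reflects xs ys h Txs = All.tabulate λ {y} y∈ → decidable-stable (T? y) λ ¬Ty →
    b∉cl∅ (proj₁ (idempotent emptySub)
      (monotone _ (cl emptySub) xs⊆cl∅
        (h (subst (_∈ map val ys) (val-out ¬Ty) (∈-map⁺ val y∈)))))
    where
    xs⊆cl∅ : ∀ {m} → m ∈ map val xs → cl emptySub m
    xs⊆cl∅ m∈ with ∈-map⁻ val m∈
    ... | x , x∈ , refl = subst (cl emptySub) (sym (val-in (All.lookup Txs x∈))) a∈cl∅

completeness : ExcludedMiddle 0ℓ →
  {M : Set} {cl : Sub M → Sub M} → IsClosureSystem M cl →
  {a b : M} → cl emptySub a → ¬ cl emptySub b →
  {Var : Set} (Σ' : AtomSet Var) (xs ys : List Var) → WF xs ys →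
  (∀ (s : Var → M) → Satisfies Σ' (ClDep M cl) s → ClDep M cl (map s xs) (map s ys)) →
  Σ' ⊢ xs , ys
completeness em {M} {cl} isC a∈ b∉ Σ' xs ys wf valid =
  fromMembers ys wf (reflects xs ys (valid val sat) xsDetermined)
  where
  open Derivations Σ'
  open TwoPoint isC a∈ b∉ {T = Determined xs} (λ _ → em)

  sat : Satisfies Σ' (ClDep M cl) val
  sat us vs σ = satisfies us vs (closedUnderΣ σ)

  xsDetermined : All (Determined xs) xs
  xsDetermined = All.tabulate member

mainTheorem2 : ExcludedMiddle 0ℓ →
    (C : Class) →
    (∀ I R → C I R → IsDepStructure I R) →
    (Σ Set λ M → Σ (Sub M → Sub M) λ cl →
    IsClosureSystem M cl ×
    ¬ (∀ m → ¬ cl emptySub m) ×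
    ¬ (∀ m → cl emptySub m) ×
    C M (ClDep M cl)) →
    (Var : Set) (Σ' : AtomSet Var) → IsAtomSet Σ' →
    (xs ys : List Var) → WF xs ys →
    ((Σ' ⊢ xs , ys) ⇔ (Σ' ⊨[ C ] xs , ys))
mainTheorem2 em C isDep (M , cl , isC , cl∅≢∅ , cl∅≢M , inC) Var Σ' _ xs ys wf =
  mk⇔ (λ d I _⇒_ c s sat → sound (isDep I _⇒_ c) sat d)
      (λ valid → completeness em isC (proj₂ a) (proj₂ b) Σ' xs ys wf
                   (valid M (ClDep M cl) inC))
  where
  dne : {P : Set} → ¬ ¬ P → P
  dne = em⇒dne em

  a : ∃ λ m → cl emptySub m
  a = dne λ none → cl∅≢∅ λ m c → none (m , c)

  b : ∃ λ m → ¬ cl emptySub m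
  b = dne λ none → cl∅≢M λ m → dne λ c → none (m , c)
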